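{- Let $\pi_1,\pi_2$ be planes of $\mathrm{PG}(5,q)$ with $\pi_2=\pi_1^\perp$, each meeting $\mathcal Q$ in a conic $C_i=\pi_i\cap\mathcal Q$, and let $S=C_1\cup C_2$ (a union of two perpendicular conics of $\mathsf{Q}^-(5,q)$). If $S\cap H=\varnothing$, then $S^\sigma\ne S$.
   Context: Let $q>2$ be a prime power, $\mathcal Q$ an elliptic quadric $\mathsf{Q}^-(5,q)$ in $\mathrm{PG}(5,q)$ with associated polarity $\perp$, and $H$ a hyperplane with $H\cap\mathcal Q$ a parabolic quadric $\mathsf Q(4,q)$. $\sigma$ is the central collineation of $\mathrm{PG}(5,q)$ with axis $H$ and centre the point $H^\perp$ which, for each point $p\in\mathcal Q\setminus H$, maps $p$ to the other point of $\mathcal Q$ on the line joining $H^\perp$ and $p$; it is an involution stabilising $\mathcal Q$. $S^\sigma$ denotes the image of $S$ under $\sigma$. -}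

module Defs where

open import Level using (Level; _⊔_)
open import Algebra.Bundles using (CommutativeRing)
open import Data.Nat using (ℕ; _>_)
open import Data.Fin using (Fin)
import Data.Fin as Fin'
open import Data.List using (List; length)
open import Data.List.Membership.Setoid using ()
open import Data.List.Relation.Unary.Any using (Any)
open import Data.List.Relation.Unary.AllPairs using (AllPairs)
open import Data.Product using (Σ; ∃; ∃-syntax; _×_; _,_)
open import Data.Sum using (_⊎_)
open import Relation.Nullary using (¬_)
open import Relation.Binary using (Decidable)

record FiniteField (c ℓ : Level) : Set (Level.suc (c ⊔ ℓ)) where
  field
    commRing  : CommutativeRing c ℓ
  open CommutativeRing commRing public
  field
    1≉0       : ¬ (1# ≈ 0#)
    inverse   : ∀ x → ¬ (x ≈ 0#) → ∃[ y ] (x * y ≈ 1#)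
    _≟F_      : Decidable _≈_
    elements  : List Carrier
    complete  : ∀ x → Any (x ≈_) elements
    distinct  : AllPairs (λ x y → ¬ (x ≈ y)) elements

  order : ℕ
  order = length elements

-- Geometry of PG(5,q) over a finite field F.
-- Vectors of V(6,q) are functions Fin 6 → F; a point of PG(5,q) is
-- represented by a nonzero vector (up to nonzero scalar multiples).

module Geometry {c ℓ : Level} (F : FiniteField c ℓ) where
  open FiniteField F

  Vec6 : Set c
  Vec6 = Fin 6 → Carrier

  Σ6 : (Fin 6 → Carrier) → Carrier
  Σ6 f = f Fin'.zero + (f (Fin'.suc Fin'.zero) + (f (Fin'.suc (Fin'.suc Fin'.zero))
       + (f (Fin'.suc (Fin'.suc (Fin'.suc Fin'.zero)))
       + (f (Fin'.suc (Fin'.suc (Fin'.suc (Fin'.suc Fin'.zero))))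
       + f (Fin'.suc (Fin'.suc (Fin'.suc (Fin'.suc (Fin'.suc Fin'.zero)))))))))

  _⊕_ : Vec6 → Vec6 → Vec6
  (x ⊕ y) i = x i + y i

  _·_ : Carrier → Vec6 → Vec6
  (a · x) i = a * x i

  _≈V_ : Vec6 → Vec6 → Set ℓ
  x ≈V y = ∀ i → x i ≈ y i

  NonZero : Vec6 → Set ℓ
  NonZero x = ¬ (∀ i → x i ≈ 0#)

  SamePoint : Vec6 → Vec6 → Set (c ⊔ ℓ)
  SamePoint x y = ∃[ a ] (y ≈V (a · x))

  Independent3 : Vec6 → Vec6 → Vec6 → Set (c ⊔ ℓ)
  Independent3 a b d = ∀ λ₁ λ₂ λ₃ →
    (∀ i → ((λ₁ · a) ⊕ ((λ₂ · b) ⊕ (λ₃ · d))) i ≈ 0#) →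
    (λ₁ ≈ 0#) × (λ₂ ≈ 0#) × (λ₃ ≈ 0#)

  Span3 : Vec6 → Vec6 → Vec6 → Vec6 → Set (c ⊔ ℓ)
  Span3 a b d x = ∃[ λ₁ ] ∃[ λ₂ ] ∃[ λ₃ ] (x ≈V ((λ₁ · a) ⊕ ((λ₂ · b) ⊕ (λ₃ · d))))

  Span2 : Vec6 → Vec6 → Vec6 → Set (c ⊔ ℓ)
  Span2 a b x = ∃[ λ₁ ] ∃[ λ₂ ] (x ≈V ((λ₁ · a) ⊕ (λ₂ · b)))

  -- Quadratic forms on V(6,q), given by a coefficient matrix:
  --   Q(x) = Σ_i Σ_j A i j x_i x_j
  -- (every quadratic form arises this way, in every characteristic).

  QForm : Set c
  QForm = Fin 6 → Fin 6 → Carrier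

  module _ (A : QForm) where

    Qv : Vec6 → Carrier
    Qv x = Σ6 (λ i → Σ6 (λ j → A i j * (x i * x j)))

    Bf : Vec6 → Vec6 → Carrier
    Bf x y = Qv (x ⊕ y) - Qv x - Qv y

    NonsingularOn : (Vec6 → Set (c ⊔ ℓ)) → Set (c ⊔ ℓ)
    NonsingularOn U = ¬ (∃[ v ] (U v × NonZero v × (Qv v ≈ 0#) ×
                                  (∀ w → U w → Bf v w ≈ 0#)))

    Whole : Vec6 → Set (c ⊔ ℓ)
    Whole _ = Level.Lift (c ⊔ ℓ) Data.Unit.⊤
      where import Data.Unit

    -- Q defines an elliptic quadric Q⁻(5,q): it is non-singular and
    -- contains no plane (no totally singular 3-dimensional subspace).
    Elliptic : Set (c ⊔ ℓ)
    Elliptic = NonsingularOn Whole ×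
      ¬ (∃[ a ] ∃[ b ] ∃[ d ] (Independent3 a b d ×
            (∀ x → Span3 a b d x → Qv x ≈ 0#)))

    Perp : (Vec6 → Set (c ⊔ ℓ)) → Vec6 → Set (c ⊔ ℓ)
    Perp U x = ∀ y → U y → Bf x y ≈ 0#

    Hyperplane : Vec6 → Vec6 → Set (c ⊔ ℓ)
    Hyperplane h x = Level.Lift (c ⊔ ℓ) (Σ6 (λ i → h i * x i) ≈ 0#)

    IsPole : Vec6 → (Vec6 → Set (c ⊔ ℓ)) → Set (c ⊔ ℓ)
    IsPole ctr H = NonZero ctr × (∀ x → (Bf ctr x ≈ 0# → H x) × (H x → Bf ctr x ≈ 0#))

    -- p' is (a representative of) σ(p), for a point p of Q not in H:
    -- the other point of Q on the line joining the centre and p.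
    SigmaImage : Vec6 → Vec6 → Vec6 → Set (c ⊔ ℓ)
    SigmaImage ctr p p' = NonZero p' × (Qv p' ≈ 0#) × Span2 ctr p p' × ¬ SamePoint p p'

    ImageSigma : Vec6 → (Vec6 → Set (c ⊔ ℓ)) → Vec6 → Set (c ⊔ ℓ)
    ImageSigma ctr S x = ∃[ p ] (S p × SigmaImage ctr p x)

    TwoConics : Vec6 → Vec6 → Vec6 → Vec6 → Set (c ⊔ ℓ)
    TwoConics a b d x = NonZero x × (Qv x ≈ 0#) ×
                        (Span3 a b d x ⊎ Perp (Span3 a b d) x)

module Submission where

-- Both conics are nonempty: a ternary quadratic form over a finite field is isotropic
-- (complete squares, then count the values of α s² + e), and π₁^⊥ is spanned by three
-- independent vectors, found by row reduction.  Take p ∈ C₁.  If S ⊆ S^σ, then p = σ(q) for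
-- some q ∈ S, and the line pq passes through the centre H^⊥, so any vector orthogonal to both
-- p and q is orthogonal to H^⊥, i.e. lies in H.  If q ∈ π₁, every point of C₂ is such a
-- vector; if q ∈ π₁^⊥, q itself is (it is singular).  Either way S meets H.  Only the inclusion
-- S ⊆ S^σ is used.

open import Level using (Level; _⊔_; Lift; lift; lower)
open import Algebra.Bundles using (CommutativeRing)
open import Algebra.Solver.Ring.AlmostCommutativeRing
  using (fromCommutativeRing; _-Raw-AlmostCommutative⟶_)
open import Data.Bool using (Bool; true; false)
open import Data.Empty using (⊥; ⊥-elim)
open import Data.Fin using (Fin; zero; suc; punchIn)
import Data.Fin.Properties as Fin
open import Data.Integer as ℤ using (ℤ; +_; -[1+_]; _⊖_)
import Data.Integer.Properties as ℤ
open import Data.List using (List; _∷_; length; lookup; map; _++_)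
import Data.List.Properties as List
open import Data.List.Relation.Unary.AllPairs using (_∷_)
open import Data.List.Relation.Unary.Any as Any using (here; there)
import Data.List.Membership.Setoid as Membership
open import Data.List.Membership.Setoid.Properties
  using (index-injective; ∈-lookup; ∈-resp-≈; All[≉]⇒∉; ∉⇒All[≉]; ∈-map⁺; ∈-map⁻; ∈-++⁺ˡ; ∈-++⁺ʳ; ∈-++⁻)
open import Data.List.Relation.Binary.Disjoint.Setoid using (Disjoint)
open import Data.Maybe using (Maybe; just; nothing)
open import Data.Nat as ℕ using (ℕ; zero; suc; _>_)
import Data.Nat.Properties as ℕ
open import Data.Product using (∃; ∃-syntax; _×_; _,_; proj₁; proj₂)
open import Data.Product.Relation.Binary.Pointwise.NonDependent using (_×ₛ_)
open import Data.Sum as Sum using (_⊎_; inj₁; inj₂; [_,_])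
open import Data.Unit using (⊤; tt)
open import Function using (id)
open import Relation.Binary.Bundles using (Setoid)
open import Relation.Binary.PropositionalEquality as ≡ using (_≡_; _≢_)
open import Relation.Nullary using (¬_; ¬?; Dec; yes; no; does)
import Relation.Nullary.Decidable as Dec
open import Relation.Nullary.Decidable using (dec-true; decidable-stable)
open import Relation.Nullary.Negation using (contradiction)

open import Defs

-- The ring solver needs a coefficient ring with decidable equality, and ℤ maps into every
-- ring.  With the optimised multiplication the constants 1 and 2 denote 1# and 1# + 1#
-- definitionally, so they match the literals in goals.
module IntegerCoefficients {c ℓ : Level} (R : CommutativeRing c ℓ) where
  open CommutativeRing R
  open import Algebra.Properties.Ring ring
    using (-‿involutive; -0#≈0#; -‿distribˡ-*; -‿distribʳ-*; -‿+-comm)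
  open import Algebra.Properties.CommutativeSemigroup +-commutativeSemigroup
    using () renaming (interchange to +-interchange)
  open import Algebra.Properties.Monoid.Mult.TCOptimised +-monoid
    using (1+×; ×-homo-+) renaming (_×_ to _×ₙ_)
  open import Algebra.Properties.Semiring.Mult.TCOptimised semiring using (×1-homo-*)
  open import Relation.Binary.Reasoning.Setoid setoid

  fromℕ : ℕ → Carrier
  fromℕ n = n ×ₙ 1#

  fromℤ : ℤ → Carrier
  fromℤ (+ n)    = fromℕ n
  fromℤ -[1+ n ] = - fromℕ (suc n)

  fromℤ-neg : ∀ i → fromℤ (ℤ.- i) ≈ - fromℤ i
  fromℤ-neg -[1+ n ]    = sym (-‿involutive _)
  fromℤ-neg (+ zero)    = sym -0#≈0#
  fromℤ-neg (+ suc n)   = refl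

  fromℤ-⊖ : ∀ m n → fromℤ (m ⊖ n) ≈ fromℕ m - fromℕ n
  fromℤ-⊖ m zero = begin
    fromℤ (m ⊖ 0)       ≡⟨ ≡.cong fromℤ (ℤ.⊖-≥ {m} ℕ.z≤n) ⟩
    fromℕ m             ≈⟨ +-identityʳ _ ⟨
    fromℕ m + 0#        ≈⟨ +-congˡ -0#≈0# ⟨
    fromℕ m - 0#        ∎
  fromℤ-⊖ zero (suc n) = sym (+-identityˡ _)
  fromℤ-⊖ (suc m) (suc n) = begin
    fromℤ (suc m ⊖ suc n)          ≡⟨ ≡.cong fromℤ (ℤ.[1+m]⊖[1+n]≡m⊖n m n) ⟩
    fromℤ (m ⊖ n)                  ≈⟨ fromℤ-⊖ m n ⟩
    fromℕ m - fromℕ n              ≈⟨ +-identityˡ _ ⟨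
    0# + (fromℕ m - fromℕ n)       ≈⟨ +-congʳ (-‿inverseʳ 1#) ⟨
    (1# - 1#) + (fromℕ m - fromℕ n) ≈⟨ +-interchange 1# (- 1#) (fromℕ m) (- fromℕ n) ⟩
    (1# + fromℕ m) + (- 1# - fromℕ n) ≈⟨ +-congˡ (-‿+-comm 1# (fromℕ n)) ⟩
    (1# + fromℕ m) - (1# + fromℕ n) ≈⟨ +-cong (1+× m 1#) (-‿cong (1+× n 1#)) ⟨
    fromℕ (suc m) - fromℕ (suc n)  ∎

  fromℤ-+ : ∀ i j → fromℤ (i ℤ.+ j) ≈ fromℤ i + fromℤ j
  fromℤ-+ (+ m)    (+ n)    = ×-homo-+ 1# m n
  fromℤ-+ (+ m)    -[1+ n ] = fromℤ-⊖ m (suc n)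
  fromℤ-+ -[1+ m ] (+ n)    = trans (fromℤ-⊖ n (suc m)) (+-comm _ _)
  fromℤ-+ -[1+ m ] -[1+ n ] = begin
    - fromℕ (suc (suc (m ℕ.+ n)))       ≡⟨ ≡.cong (λ k → - fromℕ (suc k)) (ℕ.+-suc m n) ⟨
    - fromℕ (suc m ℕ.+ suc n)           ≈⟨ -‿cong (×-homo-+ 1# (suc m) (suc n)) ⟩
    - (fromℕ (suc m) + fromℕ (suc n))   ≈⟨ -‿+-comm _ _ ⟨
    - fromℕ (suc m) - fromℕ (suc n)     ∎

  fromℤ-*-+ : ∀ m j → fromℤ (+ m ℤ.* j) ≈ fromℕ m * fromℤ j
  fromℤ-*-+ m (+ n) = begin
    fromℤ (+ m ℤ.* + n)   ≡⟨ ≡.cong fromℤ (ℤ.pos-* m n) ⟨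
    fromℕ (m ℕ.* n)       ≈⟨ ×1-homo-* m n ⟩
    fromℕ m * fromℕ n     ∎
  fromℤ-*-+ m -[1+ n ] = begin
    fromℤ (+ m ℤ.* ℤ.- + suc n)       ≡⟨ ≡.cong fromℤ (ℤ.neg-distribʳ-* (+ m) (+ suc n)) ⟨
    fromℤ (ℤ.- (+ m ℤ.* + suc n))     ≈⟨ fromℤ-neg (+ m ℤ.* + suc n) ⟩
    - fromℤ (+ m ℤ.* + suc n)         ≈⟨ -‿cong (fromℤ-*-+ m (+ suc n)) ⟩
    - (fromℕ m * fromℕ (suc n))       ≈⟨ -‿distribʳ-* _ _ ⟩
    fromℕ m * - fromℕ (suc n)         ∎

  fromℤ-* : ∀ i j → fromℤ (i ℤ.* j) ≈ fromℤ i * fromℤ j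
  fromℤ-* (+ m)    j = fromℤ-*-+ m j
  fromℤ-* -[1+ m ] j = begin
    fromℤ (ℤ.- + suc m ℤ.* j)         ≡⟨ ≡.cong fromℤ (ℤ.neg-distribˡ-* (+ suc m) j) ⟨
    fromℤ (ℤ.- (+ suc m ℤ.* j))       ≈⟨ fromℤ-neg (+ suc m ℤ.* j) ⟩
    - fromℤ (+ suc m ℤ.* j)           ≈⟨ -‿cong (fromℤ-*-+ (suc m) j) ⟩
    - (fromℕ (suc m) * fromℤ j)       ≈⟨ -‿distribˡ-* _ _ ⟩
    - fromℕ (suc m) * fromℤ j         ∎

  fromℤ-morphism :
    CommutativeRing.rawRing ℤ.+-*-commutativeRing -Raw-AlmostCommutative⟶ fromCommutativeRing R
  fromℤ-morphism = record
    { ⟦_⟧ = fromℤ ; +-homo = fromℤ-+ ; *-homo = fromℤ-* ; -‿homo = fromℤ-neg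
    ; 0-homo = refl ; 1-homo = refl }

  fromℤ-≟ : ∀ i j → Maybe (fromℤ i ≈ fromℤ j)
  fromℤ-≟ i j with i ℤ.≟ j
  ... | yes ≡.refl = just refl
  ... | no _       = nothing

  open import Algebra.Solver.Ring _ (fromCommutativeRing R) fromℤ-morphism fromℤ-≟ public

does⇒witness : ∀ {p} {P : Set p} (P? : Dec P) → does P? ≡ true → P
does⇒witness (yes p) _ = p
does⇒witness (no _)  ()

≤?-symmetric⇒≡ : ∀ {n} (i j : Fin n) → does (i Fin.≤? j) ≡ does (j Fin.≤? i) → i ≡ j
≤?-symmetric⇒≡ i j eq with Fin.≤-total i j
... | inj₁ i≤j = Fin.≤-antisym i≤j
                   (does⇒witness (j Fin.≤? i) (≡.trans (≡.sym eq) (dec-true (i Fin.≤? j) i≤j)))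
... | inj₂ j≤i = Fin.≤-antisym (does⇒witness (i Fin.≤? j) (≡.trans eq (dec-true (j Fin.≤? i) j≤i)))
                   j≤i

module UniqueLists {a r : Level} (S : Setoid a r) where
  open Setoid S
  open import Data.List.Relation.Unary.Unique.Setoid S using (Unique)
  open Membership S using (_∈_)

  lookup-injective : ∀ {xs} → Unique xs → ∀ i j → lookup xs i ≈ lookup xs j → i ≡ j
  lookup-injective (_  ∷ _)  zero    zero    _  = ≡.refl
  lookup-injective (x≉ ∷ _)  zero    (suc j) eq =
    contradiction (∈-resp-≈ S (sym eq) (∈-lookup S _ j)) (All[≉]⇒∉ S x≉)
  lookup-injective (x≉ ∷ _)  (suc i) zero    eq =
    contradiction (∈-resp-≈ S eq (∈-lookup S _ i)) (All[≉]⇒∉ S x≉)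
  lookup-injective (_  ∷ u)  (suc i) (suc j) eq = ≡.cong suc (lookup-injective u i j eq)

  index-cong : ∀ {x y xs} → Unique xs → x ≈ y → (p : x ∈ xs) (q : y ∈ xs) →
               Any.index p ≡ Any.index q
  index-cong _        _   (here _)   (here _)   = ≡.refl
  index-cong (z≉ ∷ _) x≈y (here x≈z) (there q) =
    contradiction (∈-resp-≈ S (trans (sym x≈y) x≈z) q) (All[≉]⇒∉ S z≉)
  index-cong (z≉ ∷ _) x≈y (there p)  (here y≈z) =
    contradiction (∈-resp-≈ S (trans x≈y y≈z) p) (All[≉]⇒∉ S z≉)
  index-cong (_  ∷ u) x≈y (there p)  (there q) = ≡.cong suc (index-cong u x≈y p q)

  unique⇒length≤ : ∀ {xs ys} → Unique xs → (∀ {x} → x ∈ xs → x ∈ ys) → length xs ℕ.≤ length ys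
  unique⇒length≤ {xs} xs! xs⊆ys = Fin.injective⇒≤ λ {i} {j} eq →
    lookup-injective xs! i j
      (index-injective S (xs⊆ys (∈-lookup S xs i)) (xs⊆ys (∈-lookup S xs j)) eq)

module FieldArithmetic {c ℓ : Level} (F : FiniteField c ℓ) where
  open FiniteField F
  open IntegerCoefficients commRing
  open import Algebra.Properties.Ring ring
    using (-0#≈0#; -‿injective; +-inverseˡ-unique; x∙y⁻¹≈ε⇒x≈y; x≈y⇒x∙y⁻¹≈ε)
  open import Relation.Binary.Reasoning.Setoid setoid

  _⁻¹⟨_⟩ : ∀ x → x ≉ 0# → Carrier
  x ⁻¹⟨ x≉0 ⟩ = proj₁ (inverse x x≉0)

  x*x⁻¹≈1 : ∀ {x} (x≉0 : x ≉ 0#) → x * x ⁻¹⟨ x≉0 ⟩ ≈ 1#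
  x*x⁻¹≈1 {x} x≉0 = proj₂ (inverse x x≉0)

  x≉0⇒x*y≈0⇒y≈0 : ∀ {x y} → x ≉ 0# → x * y ≈ 0# → y ≈ 0#
  x≉0⇒x*y≈0⇒y≈0 {x} {y} x≉0 xy≈0 = begin
    y                       ≈⟨ *-identityˡ y ⟨
    1# * y                  ≈⟨ *-congʳ (trans (*-comm _ _) (x*x⁻¹≈1 x≉0)) ⟨
    (x ⁻¹⟨ x≉0 ⟩ * x) * y   ≈⟨ *-assoc _ _ _ ⟩
    x ⁻¹⟨ x≉0 ⟩ * (x * y)   ≈⟨ *-congˡ xy≈0 ⟩
    x ⁻¹⟨ x≉0 ⟩ * 0#        ≈⟨ zeroʳ _ ⟩
    0#                      ∎

  x*y≈0⇒x≈0⊎y≈0 : ∀ {x y} → x * y ≈ 0# → x ≈ 0# ⊎ y ≈ 0#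
  x*y≈0⇒x≈0⊎y≈0 {x} xy≈0 with x ≟F 0#
  ... | yes x≈0 = inj₁ x≈0
  ... | no  x≉0 = inj₂ (x≉0⇒x*y≈0⇒y≈0 x≉0 xy≈0)

  x≉0⇒y≉0⇒x*y≉0 : ∀ {x y} → x ≉ 0# → y ≉ 0# → x * y ≉ 0#
  x≉0⇒y≉0⇒x*y≉0 x≉0 y≉0 xy≈0 = [ x≉0 , y≉0 ] (x*y≈0⇒x≈0⊎y≈0 xy≈0)

  *-cancelˡ : ∀ {x y z} → x ≉ 0# → x * y ≈ x * z → y ≈ z
  *-cancelˡ {x} {y} {z} x≉0 xy≈xz = x∙y⁻¹≈ε⇒x≈y y z (x≉0⇒x*y≈0⇒y≈0 x≉0 (begin
    x * (y - z)     ≈⟨ solve 3 (λ x y z → x :* (y :- z) := x :* y :- x :* z) refl x y z ⟩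
    x * y - x * z   ≈⟨ x≈y⇒x∙y⁻¹≈ε xy≈xz ⟩
    0#              ∎))

  x²≈y²⇒x≈±y : ∀ {x y} → x * x ≈ y * y → x ≈ y ⊎ x ≈ - y
  x²≈y²⇒x≈±y {x} {y} x²≈y² =
    Sum.map (x∙y⁻¹≈ε⇒x≈y x y) (+-inverseˡ-unique x y) (x*y≈0⇒x≈0⊎y≈0 (begin
      (x - y) * (x + y)   ≈⟨ solve 2 (λ x y → (x :- y) :* (x :+ y) := x :* x :- y :* y) refl x y ⟩
      x * x - y * y       ≈⟨ x≈y⇒x∙y⁻¹≈ε x²≈y² ⟩
      0#                  ∎))

  -x≉0 : ∀ {x} → x ≉ 0# → - x ≉ 0#
  -x≉0 x≉0 -x≈0 = x≉0 (-‿injective (trans -x≈0 (sym -0#≈0#)))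

  0≈±x⇒x≈0 : ∀ {x} → 0# ≈ x ⊎ 0# ≈ - x → x ≈ 0#
  0≈±x⇒x≈0 = [ sym , (λ 0≈-x → -‿injective (trans (sym 0≈-x) (sym -0#≈0#))) ]

  two : Carrier
  two = 1# + 1#


module SquareValues {c ℓ : Level} (F : FiniteField c ℓ) where
  open FiniteField F
  open IntegerCoefficients commRing
  open FieldArithmetic F
  open import Algebra.Properties.Ring ring using (-0#≈0#; -‿involutive; +-cancelʳ)
  open import Algebra.Definitions _≈_ using (Congruent₁)
  open import Relation.Binary.Reasoning.Setoid setoid

  position : Carrier → Fin order
  position x = Any.index (complete x)

  position-cong : ∀ {x y} → x ≈ y → position x ≡ position y
  position-cong x≈y = UniqueLists.index-cong setoid distinct x≈y (complete _) (complete _)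

  position-injective : ∀ {x y} → position x ≡ position y → x ≈ y
  position-injective = index-injective setoid (complete _) (complete _)

  -- Picks one element out of each pair {x, - x}.
  positive : Carrier → Bool
  positive x = does (position x Fin.≤? position (- x))

  positive-cong : ∀ {x y} → x ≈ y → positive x ≡ positive y
  positive-cong x≈y = ≡.cong₂ (λ i j → does (i Fin.≤? j)) (position-cong x≈y) (position-cong (-‿cong x≈y))

  positive-0# : positive 0# ≡ true
  positive-0# = ≡.trans (≡.cong (λ j → does (position 0# Fin.≤? j)) (position-cong -0#≈0#))
                        (dec-true (position 0# Fin.≤? position 0#) Fin.≤-refl)

  positive-separates : ∀ {x y} → x ≈ - y → positive x ≡ positive y → x ≈ y
  positive-separates {x} {y} x≈-y px≡py = position-injective (≤?-symmetric⇒≡ _ _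
    (≡.trans (≡.cong (λ j → does (position x Fin.≤? j)) (≡.sym (position-cong -x≈y)))
      (≡.trans px≡py (≡.cong (λ j → does (position y Fin.≤? j)) (position-cong (sym x≈-y))))))
    where
    -x≈y : - x ≈ y
    -x≈y = trans (-‿cong x≈-y) (-‿involutive y)

  ∃? : ∀ {p} {P : Carrier → Set p} → (∀ {x y} → x ≈ y → P x → P y) → (∀ x → Dec (P x)) → Dec (∃ P)
  ∃? resp P? = Dec.map′ Any.satisfied
    (λ (x , px) → Any.map (λ x≈e → resp x≈e px) (complete x)) (Any.any? P? elements)

  ±-Injective : (Carrier → Carrier) → Set (c ⊔ ℓ)
  ±-Injective f = ∀ {x y} → f x ≈ f y → x ≈ y ⊎ x ≈ - y

  Tagged : Setoid c ℓ
  Tagged = setoid ×ₛ ≡.setoid Bool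

  tagged-elements : List (Carrier × Bool)
  tagged-elements = map (_, true) elements ++ map (_, false) elements

  ∈-tagged-elements : ∀ v → Membership._∈_ Tagged v tagged-elements
  ∈-tagged-elements (x , true)  = ∈-++⁺ˡ Tagged (∈-map⁺ setoid Tagged (_, ≡.refl) (complete x))
  ∈-tagged-elements (x , false) = ∈-++⁺ʳ Tagged _ (∈-map⁺ setoid Tagged (_, ≡.refl) (complete x))

  -- If f and g had disjoint images, the 2q + 1 pairs (f 0#, false), (f s, positive s) and
  -- (g t, positive t) would be pairwise distinct in the 2q-element set Carrier × Bool: the tag
  -- separates s from - s, and (f 0#, false) is new because positive 0# holds.
  images-meet : ∀ {f g} → Congruent₁ f → Congruent₁ g → ±-Injective f → ±-Injective g →
                ∃[ s ] ∃[ t ] f s ≈ g t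
  images-meet {f} {g} f-cong g-cong f-inj g-inj
    with ∃? (λ s≈s′ (t , fs≈gt) → t , trans (f-cong (sym s≈s′)) fs≈gt)
            (λ s → ∃? (λ t≈t′ fs≈gt → trans fs≈gt (g-cong t≈t′)) (λ t → f s ≟F g t))
  ... | yes meet = meet
  ... | no ¬meet = ⊥-elim (ℕ.1+n≰n (≡.subst₂ ℕ._≤_ length-values length-tagged-elements
                              (UniqueLists.unique⇒length≤ Tagged values! (λ {v} _ → ∈-tagged-elements v))))
    where
    open Membership Tagged using (_∉_)
    open import Data.List.Relation.Unary.Unique.Setoid.Properties using (map⁺; ++⁺)
    open import Data.List.Relation.Unary.Unique.Setoid Tagged using (Unique)

    tag : (Carrier → Carrier) → Carrier → Carrier × Bool
    tag h s = h s , positive s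

    tag-injective : ∀ {h} → ±-Injective h → ∀ {s t} → Setoid._≈_ Tagged (tag h s) (tag h t) → s ≈ t
    tag-injective h-inj (hs≈ht , ps≡pt) = [ id , (λ s≈-t → positive-separates s≈-t ps≡pt) ] (h-inj hs≈ht)

    fvalues gvalues : List (Carrier × Bool)
    fvalues = map (tag f) elements
    gvalues = map (tag g) elements

    values : List (Carrier × Bool)
    values = (f 0# , false) ∷ fvalues ++ gvalues

    head∉ : (f 0# , false) ∉ fvalues ++ gvalues
    head∉ v∈ with ∈-++⁻ Tagged fvalues v∈
    ... | inj₁ v∈f with ∈-map⁻ setoid Tagged v∈f
    ...   | s , _ , (f0≈fs , false≡ps) =
      contradiction (≡.trans false≡ps (≡.trans (positive-cong (0≈±x⇒x≈0 (f-inj f0≈fs))) positive-0#)) λ ()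
    head∉ v∈ | inj₂ v∈g with ∈-map⁻ setoid Tagged v∈g
    ...   | t , _ , (f0≈gt , _) = ¬meet (0# , t , f0≈gt)

    disjoint : Disjoint Tagged fvalues gvalues
    disjoint (v∈f , v∈g) with ∈-map⁻ setoid Tagged v∈f | ∈-map⁻ setoid Tagged v∈g
    ... | s , _ , (v≈fs , _) | t , _ , (v≈gt , _) = ¬meet (s , t , trans (sym v≈fs) v≈gt)

    values! : Unique values
    values! = ∉⇒All[≉] Tagged head∉
            ∷ ++⁺ Tagged (map⁺ setoid Tagged (tag-injective f-inj) distinct)
                         (map⁺ setoid Tagged (tag-injective g-inj) distinct) disjoint

    length-values : length values ≡ suc (order ℕ.+ order)
    length-values = ≡.cong suc (≡.trans (List.length-++ fvalues)
                      (≡.cong₂ ℕ._+_ (List.length-map (tag f) elements) (List.length-map (tag g) elements)))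

    length-tagged-elements : length tagged-elements ≡ order ℕ.+ order
    length-tagged-elements = ≡.trans (List.length-++ (map (_, true) elements))
      (≡.cong₂ ℕ._+_ (List.length-map (_, true) elements) (List.length-map (_, false) elements))

  scaled-squares-meet : ∀ {α β} e e′ → α ≉ 0# → β ≉ 0# →
                        ∃[ s ] ∃[ t ] α * (s * s) + e ≈ β * (t * t) + e′
  scaled-squares-meet e e′ α≉0 β≉0 =
    images-meet (λ x≈y → +-congʳ (*-congˡ (*-cong x≈y x≈y))) (λ x≈y → +-congʳ (*-congˡ (*-cong x≈y x≈y)))
                (±-injective α≉0) (±-injective β≉0)
    where
    ±-injective : ∀ {α e} → α ≉ 0# → ±-Injective (λ s → α * (s * s) + e)
    ±-injective {e = e} α≉0 eq = x²≈y²⇒x≈±y (*-cancelˡ α≉0 (+-cancelʳ e _ _ eq))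

  two≈0⇒∃√ : two ≈ 0# → ∀ r → ∃[ x ] x * x ≈ r
  two≈0⇒∃√ two≈0 r with scaled-squares-meet 0# r 1≉0 1≉0
  ... | s , t , s²≈t²+r = s - t , (begin
    (s - t) * (s - t)
      ≈⟨ expand s t ⟩
    (1# * (s * s) + 0#) - 1# * (t * t) + two * (t * t - s * t)
      ≈⟨ +-cong (+-congʳ s²≈t²+r) (trans (*-congʳ two≈0) (zeroˡ _)) ⟩
    (1# * (t * t) + r) - 1# * (t * t) + 0#
      ≈⟨ cancel t r ⟩
    r ∎)
    where
    expand : ∀ s t → (s - t) * (s - t) ≈ (1# * (s * s) + 0#) - 1# * (t * t) + two * (t * t - s * t)
    expand = solve 2 (λ s t → (s :- t) :* (s :- t)
      := (con (+ 1) :* (s :* s) :+ con (+ 0)) :- con (+ 1) :* (t :* t)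
         :+ con (+ 2) :* (t :* t :- s :* t)) refl
    cancel : ∀ t r → (1# * (t * t) + r) - 1# * (t * t) + 0# ≈ r
    cancel = solve 2 (λ t r → (con (+ 1) :* (t :* t) :+ r) :- con (+ 1) :* (t :* t) :+ con (+ 0) := r) refl

module TernaryForms {c ℓ : Level} (F : FiniteField c ℓ) where
  open FiniteField F
  open IntegerCoefficients commRing
  open FieldArithmetic F
  open SquareValues F using (scaled-squares-meet; two≈0⇒∃√)
  open import Algebra.Properties.Ring ring using (x≈y⇒x∙y⁻¹≈ε)
  open import Relation.Binary.Reasoning.Setoid setoid

  linear-form-zero : ∀ p q → ∃[ y ] ∃[ z ] ((y ≉ 0# ⊎ z ≉ 0#) × p * y + q * z ≈ 0#)
  linear-form-zero p q with p ≟F 0#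
  ... | yes p≈0 = 1# , 0# , inj₁ 1≉0 , (begin
    p * 1# + q * 0#   ≈⟨ solve 2 (λ p q → p :* con (+ 1) :+ q :* con (+ 0) := p) refl p q ⟩
    p                 ≈⟨ p≈0 ⟩
    0#                ∎)
  ... | no  p≉0 = q , - p , inj₂ (-x≉0 p≉0) ,
    solve 2 (λ p q → p :* q :+ q :* (:- p) := con (+ 0)) refl p q

  quadratic : (a b c u : Carrier) → Carrier
  quadratic a b c u = a * (u * u) + b * u + c

  complete-square : ∀ {a k} b c u → two * a * k ≈ 1# →
                    quadratic a b c (u - b * k) ≈ a * (u * u) + (c - a * (k * k) * (b * b))
  complete-square {a} {k} b c u 2ak≈1 = begin
    quadratic a b c (u - b * k)
      ≈⟨ identity a b c k u ⟩
    a * (u * u) + (c - a * (k * k) * (b * b)) + (1# - two * a * k) * (b * u - b * b * k)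
      ≈⟨ +-congˡ (trans (*-congʳ (x≈y⇒x∙y⁻¹≈ε (sym 2ak≈1))) (zeroˡ _)) ⟩
    a * (u * u) + (c - a * (k * k) * (b * b)) + 0#
      ≈⟨ +-identityʳ _ ⟩
    a * (u * u) + (c - a * (k * k) * (b * b)) ∎
    where
    identity : ∀ a b c k u → quadratic a b c (u - b * k) ≈
               a * (u * u) + (c - a * (k * k) * (b * b)) + (1# - two * a * k) * (b * u - b * b * k)
    identity = solve 5 (λ a b c k u →
      a :* ((u :- b :* k) :* (u :- b :* k)) :+ b :* (u :- b :* k) :+ c
      := a :* (u :* u) :+ (c :- a :* (k :* k) :* (b :* b))
         :+ (con (+ 1) :- con (+ 2) :* a :* k) :* (b :* u :- b :* b :* k)) refl

  NonTrivial : Carrier → Carrier → Carrier → Set ℓ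
  NonTrivial x y z = x ≉ 0# ⊎ y ≉ 0# ⊎ z ≉ 0#

  ternary : (c₁ c₂ c₃ c₁₂ c₁₃ c₂₃ x y z : Carrier) → Carrier
  ternary c₁ c₂ c₃ c₁₂ c₁₃ c₂₃ x y z =
    c₁ * (x * x) + c₂ * (y * y) + c₃ * (z * z) + c₁₂ * (x * y) + c₁₃ * (x * z) + c₂₃ * (y * z)

  module TernaryForm (c₁ c₂ c₃ c₁₂ c₁₃ c₂₃ : Carrier) where

    T : Carrier → Carrier → Carrier → Carrier
    T = ternary c₁ c₂ c₃ c₁₂ c₁₃ c₂₃

    Isotropic : Set (c ⊔ ℓ)
    Isotropic = ∃[ x ] ∃[ y ] ∃[ z ] (NonTrivial x y z × T x y z ≈ 0#)

    b : Carrier → Carrier → Carrier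
    b y z = c₁₂ * y + c₁₃ * z

    r : Carrier → Carrier → Carrier
    r y z = c₂ * (y * y) + c₃ * (z * z) + c₂₃ * (y * z)

    T≈quadratic : ∀ x y z → T x y z ≈ quadratic c₁ (b y z) (r y z) x
    T≈quadratic = solve 9 (λ c₁ c₂ c₃ c₁₂ c₁₃ c₂₃ x y z →
      c₁ :* (x :* x) :+ c₂ :* (y :* y) :+ c₃ :* (z :* z)
        :+ c₁₂ :* (x :* y) :+ c₁₃ :* (x :* z) :+ c₂₃ :* (y :* z)
      := c₁ :* (x :* x) :+ (c₁₂ :* y :+ c₁₃ :* z) :* x
        :+ (c₂ :* (y :* y) :+ c₃ :* (z :* z) :+ c₂₃ :* (y :* z)))
      refl c₁ c₂ c₃ c₁₂ c₁₃ c₂₃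

    c₁≈0⇒isotropic : c₁ ≈ 0# → Isotropic
    c₁≈0⇒isotropic c₁≈0 = 1# , 0# , 0# , inj₁ 1≉0 , (begin
      T 1# 0# 0#   ≈⟨ solve 6 (λ c₁ c₂ c₃ c₁₂ c₁₃ c₂₃ →
                         c₁ :* (con (+ 1) :* con (+ 1)) :+ c₂ :* (con (+ 0) :* con (+ 0))
                         :+ c₃ :* (con (+ 0) :* con (+ 0)) :+ c₁₂ :* (con (+ 1) :* con (+ 0))
                         :+ c₁₃ :* (con (+ 1) :* con (+ 0)) :+ c₂₃ :* (con (+ 0) :* con (+ 0)) := c₁)
                       refl c₁ c₂ c₃ c₁₂ c₁₃ c₂₃ ⟩
      c₁           ≈⟨ c₁≈0 ⟩
      0#           ∎)

    -- In characteristic 2 every element is a square, so it suffices to kill the cross term b.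
    module Characteristic2 (c₁≉0 : c₁ ≉ 0#) (two≈0 : two ≈ 0#) where

      b≈0⇒isotropic : ∀ {y z} → (y ≉ 0# ⊎ z ≉ 0#) → b y z ≈ 0# → Isotropic
      b≈0⇒isotropic {y} {z} yz≉0 b≈0 = x , y , z , inj₂ yz≉0 , (begin
        T x y z
          ≈⟨ T≈quadratic x y z ⟩
        c₁ * (x * x) + b y z * x + r y z
          ≈⟨ +-congʳ (+-cong (*-congˡ x²≈r/c₁) (trans (*-congʳ b≈0) (zeroˡ x))) ⟩
        c₁ * (r y z * c₁⁻¹) + 0# + r y z
          ≈⟨ cancel c₁ c₁⁻¹ (r y z) ⟩
        (c₁ * c₁⁻¹) * r y z + r y z
          ≈⟨ +-congʳ (trans (*-congʳ (x*x⁻¹≈1 c₁≉0)) (*-identityˡ _)) ⟩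
        r y z + r y z
          ≈⟨ double (r y z) ⟩
        two * r y z
          ≈⟨ trans (*-congʳ two≈0) (zeroˡ _) ⟩
        0# ∎)
        where
        c₁⁻¹ = c₁ ⁻¹⟨ c₁≉0 ⟩
        x = proj₁ (two≈0⇒∃√ two≈0 (r y z * c₁⁻¹))
        x²≈r/c₁ = proj₂ (two≈0⇒∃√ two≈0 (r y z * c₁⁻¹))
        cancel : ∀ a a′ r → a * (r * a′) + 0# + r ≈ (a * a′) * r + r
        cancel = solve 3 (λ a a′ r → a :* (r :* a′) :+ con (+ 0) :+ r := (a :* a′) :* r :+ r) refl
        double : ∀ r → r + r ≈ two * r
        double = solve 1 (λ r → r :+ r := con (+ 2) :* r) refl

      isotropic-char2 : Isotropic
      isotropic-char2 =
        let y , z , yz≉0 , b≈0 = linear-form-zero c₁₂ c₁₃ in b≈0⇒isotropic yz≉0 b≈0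

    module OddCharacteristic (c₁≉0 : c₁ ≉ 0#) (two≉0 : two ≉ 0#) where

      k : Carrier
      k = (two * c₁) ⁻¹⟨ x≉0⇒y≉0⇒x*y≉0 two≉0 c₁≉0 ⟩

      2c₁k≈1 : two * c₁ * k ≈ 1#
      2c₁k≈1 = x*x⁻¹≈1 (x≉0⇒y≉0⇒x*y≉0 two≉0 c₁≉0)

      -- After the substitution x = u - b y z * k the form is c₁ u² + d y z, with d a binary form.
      d : Carrier → Carrier → Carrier
      d y z = r y z - c₁ * (k * k) * (b y z * b y z)

      T-diagonalised : ∀ u y z → T (u - b y z * k) y z ≈ c₁ * (u * u) + d y z
      T-diagonalised u y z = trans (T≈quadratic _ y z) (complete-square (b y z) (r y z) u 2c₁k≈1)

      m₂ m₁ m₀ : Carrier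
      m₂ = c₂ - c₁ * (k * k) * (c₁₂ * c₁₂)
      m₁ = c₂₃ - two * (c₁ * (k * k) * (c₁₂ * c₁₃))
      m₀ = c₃ - c₁ * (k * k) * (c₁₃ * c₁₃)

      d[1,0]≈m₂ : d 1# 0# ≈ m₂
      d[1,0]≈m₂ = solve 7 (λ c₁ c₂ c₃ c₁₂ c₁₃ c₂₃ k →
        (c₂ :* (con (+ 1) :* con (+ 1)) :+ c₃ :* (con (+ 0) :* con (+ 0)) :+ c₂₃ :* (con (+ 1) :* con (+ 0)))
        :- c₁ :* (k :* k)
           :* ((c₁₂ :* con (+ 1) :+ c₁₃ :* con (+ 0)) :* (c₁₂ :* con (+ 1) :+ c₁₃ :* con (+ 0)))
        := c₂ :- c₁ :* (k :* k) :* (c₁₂ :* c₁₂)) refl c₁ c₂ c₃ c₁₂ c₁₃ c₂₃ k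

      d[y,1]≈quadratic : ∀ y → d y 1# ≈ quadratic m₂ m₁ m₀ y
      d[y,1]≈quadratic = solve 8 (λ c₁ c₂ c₃ c₁₂ c₁₃ c₂₃ k y →
        (c₂ :* (y :* y) :+ c₃ :* (con (+ 1) :* con (+ 1)) :+ c₂₃ :* (y :* con (+ 1)))
        :- c₁ :* (k :* k) :* ((c₁₂ :* y :+ c₁₃ :* con (+ 1)) :* (c₁₂ :* y :+ c₁₃ :* con (+ 1)))
        := (c₂ :- c₁ :* (k :* k) :* (c₁₂ :* c₁₂)) :* (y :* y)
           :+ (c₂₃ :- con (+ 2) :* (c₁ :* (k :* k) :* (c₁₂ :* c₁₃))) :* y
           :+ (c₃ :- c₁ :* (k :* k) :* (c₁₃ :* c₁₃))) refl c₁ c₂ c₃ c₁₂ c₁₃ c₂₃ k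

      m₂≈0⇒isotropic : m₂ ≈ 0# → Isotropic
      m₂≈0⇒isotropic m₂≈0 = 0# - b 1# 0# * k , 1# , 0# , inj₂ (inj₁ 1≉0) , (begin
        T (0# - b 1# 0# * k) 1# 0#   ≈⟨ T-diagonalised 0# 1# 0# ⟩
        c₁ * (0# * 0#) + d 1# 0#     ≈⟨ +-cong (trans (*-congˡ (zeroˡ 0#)) (zeroʳ c₁)) d[1,0]≈m₂ ⟩
        0# + m₂                      ≈⟨ +-identityˡ m₂ ⟩
        m₂                           ≈⟨ m₂≈0 ⟩
        0#                           ∎)

      module Nondegenerate (m₂≉0 : m₂ ≉ 0#) where

        j : Carrier
        j = (two * m₂) ⁻¹⟨ x≉0⇒y≉0⇒x*y≉0 two≉0 m₂≉0 ⟩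

        2m₂j≈1 : two * m₂ * j ≈ 1#
        2m₂j≈1 = x*x⁻¹≈1 (x≉0⇒y≉0⇒x*y≉0 two≉0 m₂≉0)

        m : Carrier
        m = m₀ - m₂ * (j * j) * (m₁ * m₁)

        d[t-m₁j,1]≈m₂t²+m : ∀ t → d (t - m₁ * j) 1# ≈ m₂ * (t * t) + m
        d[t-m₁j,1]≈m₂t²+m t = trans (d[y,1]≈quadratic _) (complete-square m₁ m₀ t 2m₂j≈1)

        isotropic-nondegenerate : Isotropic
        isotropic-nondegenerate with scaled-squares-meet 0# (- m) c₁≉0 (-x≉0 m₂≉0)
        ... | s , t , c₁s²≈-m₂t²-m = s - b y 1# * k , y , 1# , inj₂ (inj₂ 1≉0) , (begin
          T (s - b y 1# * k) y 1#                         ≈⟨ T-diagonalised s y 1# ⟩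
          c₁ * (s * s) + d y 1#                          ≈⟨ +-congˡ (d[t-m₁j,1]≈m₂t²+m t) ⟩
          c₁ * (s * s) + (m₂ * (t * t) + m)               ≈⟨ rearrange c₁ (s * s) m₂ (t * t) m ⟩
          (c₁ * (s * s) + 0#) - (- m₂ * (t * t) + - m)   ≈⟨ x≈y⇒x∙y⁻¹≈ε c₁s²≈-m₂t²-m ⟩
          0#                                             ∎)
          where
          y = t - m₁ * j
          rearrange : ∀ a u n v w → a * u + (n * v + w) ≈ (a * u + 0#) - (- n * v + - w)
          rearrange = solve 5 (λ a u n v w →
            a :* u :+ (n :* v :+ w) := (a :* u :+ con (+ 0)) :- ((:- n) :* v :+ (:- w))) refl

      isotropic-odd : Isotropic
      isotropic-odd with m₂ ≟F 0#
      ... | yes m₂≈0 = m₂≈0⇒isotropic m₂≈0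
      ... | no  m₂≉0 = Nondegenerate.isotropic-nondegenerate m₂≉0

    isotropic : Isotropic
    isotropic with c₁ ≟F 0# | two ≟F 0#
    ... | yes c₁≈0 | _         = c₁≈0⇒isotropic c₁≈0
    ... | no  c₁≉0 | yes two≈0 = Characteristic2.isotropic-char2 c₁≉0 two≈0
    ... | no  c₁≉0 | no  two≉0 = OddCharacteristic.isotropic-odd c₁≉0 two≉0

module LinearAlgebra {c ℓ : Level} (F : FiniteField c ℓ) where
  open FiniteField F hiding (zero)
  open Geometry F
  open IntegerCoefficients commRing
  open FieldArithmetic F using (_⁻¹⟨_⟩; x*x⁻¹≈1)
  open TernaryForms F using (NonTrivial)
  open import Algebra.Properties.Ring ring using (x≈y⇒x∙y⁻¹≈ε)
  open import Algebra.Properties.Semiring.Sum semiring using (sum; ∑-distrib-+; *-distribˡ-sum; sum-cong-≋)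
  open import Relation.Binary.Reasoning.Setoid setoid

  Σ6≈sum : ∀ f → Σ6 f ≈ sum f
  Σ6≈sum f = +-congˡ (+-congˡ (+-congˡ (+-congˡ (+-congˡ (sym (+-identityʳ _))))))

  Σ6-cong : ∀ {f g} → (∀ i → f i ≈ g i) → Σ6 f ≈ Σ6 g
  Σ6-cong {f} {g} f≈g = trans (Σ6≈sum f) (trans (sum-cong-≋ {x = f} {y = g} f≈g) (sym (Σ6≈sum g)))

  Σ6-+ : ∀ f g → Σ6 (λ i → f i + g i) ≈ Σ6 f + Σ6 g
  Σ6-+ f g = trans (Σ6≈sum (λ i → f i + g i)) (trans (∑-distrib-+ f g) (sym (+-cong (Σ6≈sum f) (Σ6≈sum g))))

  Σ6-* : ∀ a f → Σ6 (λ i → a * f i) ≈ a * Σ6 f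
  Σ6-* a f = trans (Σ6≈sum (λ i → a * f i)) (trans (sym (*-distribˡ-sum a f)) (*-congˡ (sym (Σ6≈sum f))))

  ΣΣ : (Fin 6 → Fin 6 → Carrier) → Carrier
  ΣΣ f = Σ6 (λ i → Σ6 (f i))

  -- Σ6 reduces, so its summands cannot be recovered by unification; they are passed explicitly.
  ΣΣ-cong : ∀ {f g} → (∀ i j → f i j ≈ g i j) → ΣΣ f ≈ ΣΣ g
  ΣΣ-cong {f} {g} f≈g = Σ6-cong {λ i → Σ6 (f i)} {λ i → Σ6 (g i)} (λ i → Σ6-cong {f i} {g i} (f≈g i))

  ΣΣ-+ : ∀ {f} g h → (∀ i j → f i j ≈ g i j + h i j) → ΣΣ f ≈ ΣΣ g + ΣΣ h
  ΣΣ-+ {f} g h f≈g+h = begin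
    ΣΣ f
      ≈⟨ ΣΣ-cong f≈g+h ⟩
    Σ6 (λ i → Σ6 (λ j → g i j + h i j))
      ≈⟨ Σ6-cong {λ i → Σ6 (λ j → g i j + h i j)} (λ i → Σ6-+ (g i) (h i)) ⟩
    Σ6 (λ i → Σ6 (g i) + Σ6 (h i))
      ≈⟨ Σ6-+ (λ i → Σ6 (g i)) (λ i → Σ6 (h i)) ⟩
    ΣΣ g + ΣΣ h ∎

  ΣΣ-* : ∀ {f} g a → (∀ i j → f i j ≈ a * g i j) → ΣΣ f ≈ a * ΣΣ g
  ΣΣ-* {f} g a f≈ag = begin
    ΣΣ f
      ≈⟨ ΣΣ-cong f≈ag ⟩
    Σ6 (λ i → Σ6 (λ j → a * g i j))
      ≈⟨ Σ6-cong {λ i → Σ6 (λ j → a * g i j)} (λ i → Σ6-* a (g i)) ⟩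
    Σ6 (λ i → a * Σ6 (g i))
      ≈⟨ Σ6-* a (λ i → Σ6 (g i)) ⟩
    a * ΣΣ g ∎

  lin3 : Carrier → Carrier → Carrier → Vec6 → Vec6 → Vec6 → Vec6
  lin3 x y z u v w = (x · u) ⊕ ((y · v) ⊕ (z · w))

  combination-cong : ∀ x y z {p q r p′ q′ r′} → p ≈ p′ → q ≈ q′ → r ≈ r′ →
                     x * p + (y * q + z * r) ≈ x * p′ + (y * q′ + z * r′)
  combination-cong x y z p≈p′ q≈q′ r≈r′ = +-cong (*-congˡ p≈p′) (+-cong (*-congˡ q≈q′) (*-congˡ r≈r′))

  nonzero-combination : ∀ {u v w x y z} → Independent3 u v w → NonTrivial x y z → NonZero (lin3 x y z u v w)
  nonzero-combination {x = x} {y} {z} indep nontrivial lin≈0 =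
    let x≈0 , y≈0 , z≈0 = indep x y z lin≈0
    in [ contradiction x≈0 , [ contradiction y≈0 , contradiction z≈0 ] ] nontrivial

  Linear : (Vec6 → Carrier) → Set (c ⊔ ℓ)
  Linear φ = ∀ w w₀ α → φ (w ⊕ (α · w₀)) ≈ φ w + α * φ w₀

  Eliminable : (Vec6 → Set (c ⊔ ℓ)) → Set (c ⊔ ℓ)
  Eliminable G = ∀ w w₀ α → G w → G w₀ → G (w ⊕ (α · w₀))

  record Echelon (m : ℕ) (G : Vec6 → Set (c ⊔ ℓ)) : Set (c ⊔ ℓ) where
    field
      vector   : Fin m → Vec6
      pivot    : Fin m → Fin 6
      at-pivot : ∀ k → vector k (pivot k) ≈ 1#
      off-pivot : ∀ k l → k ≢ l → vector k (pivot l) ≈ 0#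
      satisfies : ∀ k → G (vector k)

  eliminable-∩-kernel : ∀ {G φ} → Eliminable G → Linear φ → Eliminable (λ w → G w × φ w ≈ 0#)
  eliminable-∩-kernel G-elim φ-lin w w₀ α (Gw , φw≈0) (Gw₀ , φw₀≈0) =
    G-elim w w₀ α Gw Gw₀ ,
    trans (φ-lin w w₀ α) (trans (+-cong φw≈0 (trans (*-congˡ φw₀≈0) (zeroʳ α))) (+-identityʳ 0#))

  module Elimination {m G φ} (G-elim : Eliminable G) (φ-lin : Linear φ) (E : Echelon (suc m) G) where
    open Echelon E

    Kernel : Vec6 → Set (c ⊔ ℓ)
    Kernel w = G w × φ w ≈ 0#

    all-in-kernel : (∀ k → φ (vector k) ≈ 0#) → Echelon m Kernel
    all-in-kernel φv≈0 = record
      { vector    = λ k → vector (suc k)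
      ; pivot     = λ k → pivot (suc k)
      ; at-pivot  = λ k → at-pivot (suc k)
      ; off-pivot = λ k l k≢l → off-pivot (suc k) (suc l) (λ eq → k≢l (Fin.suc-injective eq))
      ; satisfies = λ k → satisfies (suc k) , φv≈0 (suc k)
      }

    -- Subtract multiples of vector k₀ from the other vectors to move them into the kernel of φ;
    -- vector k₀ vanishes at their pivots, so the echelon shape is preserved.
    clear-using : ∀ k₀ → φ (vector k₀) ≉ 0# → Echelon m Kernel
    clear-using k₀ φv₀≉0 = record
      { vector    = v′
      ; pivot     = λ k → pivot (punchIn k₀ k)
      ; at-pivot  = λ k → v′-entry k (at-pivot (punchIn k₀ k)) (v₀-off k)
      ; off-pivot = λ k l k≢l →
          v′-entry k (off-pivot (punchIn k₀ k) (punchIn k₀ l) (λ eq → k≢l (Fin.punchIn-injective k₀ k l eq)))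
                     (v₀-off l)
      ; satisfies = λ k → G-elim _ _ _ (satisfies (punchIn k₀ k)) (satisfies k₀) , φv′≈0 k
      }
      where
      v₀ : Vec6
      v₀ = vector k₀

      v′ : Fin m → Vec6
      v′ k = vector (punchIn k₀ k) ⊕ ((- (φ (vector (punchIn k₀ k)) * φ v₀ ⁻¹⟨ φv₀≉0 ⟩)) · v₀)

      v₀-off : ∀ k → v₀ (pivot (punchIn k₀ k)) ≈ 0#
      v₀-off k = off-pivot k₀ (punchIn k₀ k) (λ eq → Fin.punchInᵢ≢i k₀ k (≡.sym eq))

      v′-entry : ∀ k {i e} → vector (punchIn k₀ k) i ≈ e → v₀ i ≈ 0# → v′ k i ≈ e
      v′-entry k {e = e} vi≈e v₀i≈0 =
        trans (+-cong vi≈e (trans (*-congˡ v₀i≈0) (zeroʳ _))) (+-identityʳ e)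

      φv′≈0 : ∀ k → φ (v′ k) ≈ 0#
      φv′≈0 k = begin
        φ (v′ k)                                    ≈⟨ φ-lin _ _ _ ⟩
        a + (- (a * φ v₀ ⁻¹⟨ φv₀≉0 ⟩)) * φ v₀        ≈⟨ factor a (φ v₀ ⁻¹⟨ φv₀≉0 ⟩) (φ v₀) ⟩
        a * (1# - φ v₀ * φ v₀ ⁻¹⟨ φv₀≉0 ⟩)           ≈⟨ *-congˡ (x≈y⇒x∙y⁻¹≈ε (sym (x*x⁻¹≈1 φv₀≉0))) ⟩
        a * 0#                                      ≈⟨ zeroʳ a ⟩
        0#                                          ∎
        where
        a = φ (vector (punchIn k₀ k))
        factor : ∀ a i v → a + (- (a * i)) * v ≈ a * (1# - v * i)
        factor = solve 3 (λ a i v → a :+ (:- (a :* i)) :* v := a :* (con (+ 1) :- v :* i)) refl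

    eliminate-by : Dec (∃ λ k → φ (vector k) ≉ 0#) → Echelon m Kernel
    eliminate-by (yes (k₀ , φv₀≉0)) = clear-using k₀ φv₀≉0
    eliminate-by (no ∄) =
      all-in-kernel (λ k → decidable-stable (φ (vector k) ≟F 0#) (λ φvk≉0 → ∄ (k , φvk≉0)))

    eliminate : Echelon m Kernel
    eliminate = eliminate-by (Fin.any? (λ k → ¬? (φ (vector k) ≟F 0#)))

  unit : Fin 6 → Vec6
  unit k i with k Fin.≟ i
  ... | yes _ = 1#
  ... | no  _ = 0#

  standard-basis : Echelon 6 (λ _ → Lift (c ⊔ ℓ) ⊤)
  standard-basis = record
    { vector = unit ; pivot = λ k → k ; at-pivot = unit-at ; off-pivot = unit-off
    ; satisfies = λ _ → lift tt }
    where
    unit-at : ∀ k → unit k k ≈ 1#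
    unit-at k with k Fin.≟ k
    ... | yes _   = refl
    ... | no  k≢k = contradiction ≡.refl k≢k
    unit-off : ∀ k l → k ≢ l → unit k l ≈ 0#
    unit-off k l k≢l with k Fin.≟ l
    ... | yes k≡l = contradiction k≡l k≢l
    ... | no  _   = refl

  echelon-independent : ∀ {G} (E : Echelon 3 G) → let open Echelon E in
                        Independent3 (vector zero) (vector (suc zero)) (vector (suc (suc zero)))
  echelon-independent E x y z lin≈0 =
      vanishes (pivot k₀) (sym (pick₁ x y z)) (at-pivot k₀) (off-pivot k₁ k₀ (λ ())) (off-pivot k₂ k₀ (λ ()))
    , vanishes (pivot k₁) (sym (pick₂ x y z)) (off-pivot k₀ k₁ (λ ())) (at-pivot k₁) (off-pivot k₂ k₁ (λ ()))
    , vanishes (pivot k₂) (sym (pick₃ x y z)) (off-pivot k₀ k₂ (λ ())) (off-pivot k₁ k₂ (λ ())) (at-pivot k₂)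
    where
    open Echelon E
    k₀ k₁ k₂ : Fin 3
    k₀ = zero
    k₁ = suc zero
    k₂ = suc (suc zero)
    vanishes : ∀ i {e p q r} → e ≈ x * p + (y * q + z * r) →
               vector k₀ i ≈ p → vector k₁ i ≈ q → vector k₂ i ≈ r → e ≈ 0#
    vanishes i e≈ v₀≈p v₁≈q v₂≈r = trans e≈ (trans (sym (combination-cong x y z v₀≈p v₁≈q v₂≈r)) (lin≈0 i))
    pick₁ : ∀ x y z → x * 1# + (y * 0# + z * 0#) ≈ x
    pick₁ = solve 3 (λ x y z → x :* con (+ 1) :+ (y :* con (+ 0) :+ z :* con (+ 0)) := x) refl
    pick₂ : ∀ x y z → x * 0# + (y * 1# + z * 0#) ≈ y
    pick₂ = solve 3 (λ x y z → x :* con (+ 0) :+ (y :* con (+ 1) :+ z :* con (+ 0)) := y) refl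
    pick₃ : ∀ x y z → x * 0# + (y * 0# + z * 1#) ≈ z
    pick₃ = solve 3 (λ x y z → x :* con (+ 0) :+ (y :* con (+ 0) :+ z :* con (+ 1)) := z) refl

module QuadraticSpace {c ℓ : Level} (F : FiniteField c ℓ) (A : Geometry.QForm F) where
  open FiniteField F hiding (zero)
  open Geometry F
  open IntegerCoefficients commRing
  open FieldArithmetic F using (x≉0⇒x*y≈0⇒y≈0)
  open TernaryForms F using (ternary; module TernaryForm)
  open LinearAlgebra F
  open import Relation.Binary.Reasoning.Setoid setoid

  Q : Vec6 → Carrier
  Q = Qv A

  polar : Vec6 → Vec6 → Carrier
  polar x y = ΣΣ (λ i j → A i j * (x i * y j + y i * x j))

  Q-⊕ : ∀ x y → Q (x ⊕ y) ≈ Q x + Q y + polar x y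
  Q-⊕ x y = trans (ΣΣ-+ (λ i j → A i j * (x i * x j) + A i j * (y i * y j))
                        (λ i j → A i j * (x i * y j + y i * x j))
                        (λ i j → expand (A i j) (x i) (y i) (x j) (y j)))
                  (+-congʳ (ΣΣ-+ (λ i j → A i j * (x i * x j)) (λ i j → A i j * (y i * y j)) (λ i j → refl)))
    where
    expand : ∀ a xi yi xj yj →
             a * ((xi + yi) * (xj + yj)) ≈ (a * (xi * xj) + a * (yi * yj)) + a * (xi * yj + yi * xj)
    expand = solve 5 (λ a xi yi xj yj →
      a :* ((xi :+ yi) :* (xj :+ yj))
      := (a :* (xi :* xj) :+ a :* (yi :* yj)) :+ a :* (xi :* yj :+ yi :* xj)) refl

  Q-· : ∀ k x → Q (k · x) ≈ (k * k) * Q x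
  Q-· k x = ΣΣ-* (λ i j → A i j * (x i * x j)) (k * k) (λ i j → expand (A i j) k (x i) (x j))
    where
    expand : ∀ a k xi xj → a * ((k * xi) * (k * xj)) ≈ (k * k) * (a * (xi * xj))
    expand = solve 4 (λ a k xi xj → a :* ((k :* xi) :* (k :* xj)) := (k :* k) :* (a :* (xi :* xj))) refl

  Bf≈polar : ∀ x y → Bf A x y ≈ polar x y
  Bf≈polar x y = trans (+-congʳ (+-congʳ (Q-⊕ x y))) (cancel (Q x) (Q y) (polar x y))
    where
    cancel : ∀ a b c → a + b + c - a - b ≈ c
    cancel = solve 3 (λ a b c → a :+ b :+ c :- a :- b := c) refl

  polar-comm : ∀ x y → polar x y ≈ polar y x
  polar-comm x y =
    ΣΣ-cong {λ i j → A i j * (x i * y j + y i * x j)} {λ i j → A i j * (y i * x j + x i * y j)}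
    (λ i j → *-congˡ (+-comm (x i * y j) (y i * x j)))

  polar-self : ∀ x → polar x x ≈ Q x + Q x
  polar-self x = ΣΣ-+ (λ i j → A i j * (x i * x j)) (λ i j → A i j * (x i * x j))
                      (λ i j → distribˡ (A i j) (x i * x j) (x i * x j))

  polar-⊕ˡ : ∀ x y z → polar (x ⊕ y) z ≈ polar x z + polar y z
  polar-⊕ˡ x y z = ΣΣ-+ (λ i j → A i j * (x i * z j + z i * x j)) (λ i j → A i j * (y i * z j + z i * y j))
                        (λ i j → expand (A i j) (x i) (y i) (x j) (y j) (z i) (z j))
    where
    expand : ∀ a xi yi xj yj zi zj →
             a * ((xi + yi) * zj + zi * (xj + yj)) ≈ a * (xi * zj + zi * xj) + a * (yi * zj + zi * yj)
    expand = solve 7 (λ a xi yi xj yj zi zj →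
      a :* ((xi :+ yi) :* zj :+ zi :* (xj :+ yj))
      := a :* (xi :* zj :+ zi :* xj) :+ a :* (yi :* zj :+ zi :* yj)) refl

  polar-·ˡ : ∀ k x z → polar (k · x) z ≈ k * polar x z
  polar-·ˡ k x z = ΣΣ-* (λ i j → A i j * (x i * z j + z i * x j)) k
                        (λ i j → expand (A i j) k (x i) (x j) (z i) (z j))
    where
    expand : ∀ a k xi xj zi zj → a * ((k * xi) * zj + zi * (k * xj)) ≈ k * (a * (xi * zj + zi * xj))
    expand = solve 6 (λ a k xi xj zi zj →
      a :* ((k :* xi) :* zj :+ zi :* (k :* xj)) := k :* (a :* (xi :* zj :+ zi :* xj))) refl

  polar-congʳ : ∀ x {y y′} → y ≈V y′ → polar x y ≈ polar x y′
  polar-congʳ x {y} {y′} y≈y′ =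
    ΣΣ-cong {λ i j → A i j * (x i * y j + y i * x j)} {λ i j → A i j * (x i * y′ j + y′ i * x j)}
    (λ i j → *-congˡ (+-cong (*-congˡ (y≈y′ j)) (*-congʳ (y≈y′ i))))

  polar-linearˡ : ∀ t w w₀ α → polar (w ⊕ (α · w₀)) t ≈ polar w t + α * polar w₀ t
  polar-linearˡ t w w₀ α = trans (polar-⊕ˡ w (α · w₀) t) (+-congˡ (polar-·ˡ α w₀ t))

  polar-⊕ʳ : ∀ x y z → polar z (x ⊕ y) ≈ polar z x + polar z y
  polar-⊕ʳ x y z =
    trans (polar-comm z (x ⊕ y)) (trans (polar-⊕ˡ x y z) (+-cong (polar-comm x z) (polar-comm y z)))

  polar-·ʳ : ∀ k x z → polar z (k · x) ≈ k * polar z x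
  polar-·ʳ k x z = trans (polar-comm z (k · x)) (trans (polar-·ˡ k x z) (*-congˡ (polar-comm x z)))

  polar-lin3ˡ : ∀ x y z u v w t →
                polar (lin3 x y z u v w) t ≈ x * polar u t + (y * polar v t + z * polar w t)
  polar-lin3ˡ x y z u v w t = trans (polar-⊕ˡ (x · u) ((y · v) ⊕ (z · w)) t)
    (+-cong (polar-·ˡ x u t) (trans (polar-⊕ˡ (y · v) (z · w) t) (+-cong (polar-·ˡ y v t) (polar-·ˡ z w t))))

  Q-lin3 : ∀ x y z u v w →
           Q (lin3 x y z u v w) ≈ ternary (Q u) (Q v) (Q w) (polar u v) (polar u w) (polar v w) x y z
  Q-lin3 x y z u v w = begin
    Q (lin3 x y z u v w)
      ≈⟨ Q-⊕ (x · u) ((y · v) ⊕ (z · w)) ⟩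
    Q (x · u) + Q ((y · v) ⊕ (z · w)) + polar (x · u) ((y · v) ⊕ (z · w))
      ≈⟨ +-cong (+-cong (Q-· x u) Q[yv+zw]) polar[xu,yv+zw] ⟩
    (x * x) * Q u + ((y * y) * Q v + (z * z) * Q w + y * (z * polar v w))
      + x * (y * polar u v + z * polar u w)
      ≈⟨ collect (Q u) (Q v) (Q w) (polar u v) (polar u w) (polar v w) x y z ⟩
    ternary (Q u) (Q v) (Q w) (polar u v) (polar u w) (polar v w) x y z ∎
    where
    Q[yv+zw] : Q ((y · v) ⊕ (z · w)) ≈ (y * y) * Q v + (z * z) * Q w + y * (z * polar v w)
    Q[yv+zw] = trans (Q-⊕ (y · v) (z · w))
      (+-cong (+-cong (Q-· y v) (Q-· z w)) (trans (polar-·ˡ y v (z · w)) (*-congˡ (polar-·ʳ z w v))))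
    polar[xu,yv+zw] : polar (x · u) ((y · v) ⊕ (z · w)) ≈ x * (y * polar u v + z * polar u w)
    polar[xu,yv+zw] = trans (polar-·ˡ x u ((y · v) ⊕ (z · w)))
      (*-congˡ (trans (polar-⊕ʳ (y · v) (z · w) u) (+-cong (polar-·ʳ y v u) (polar-·ʳ z w u))))
    collect : ∀ qu qv qw puv puw pvw x y z →
      (x * x) * qu + ((y * y) * qv + (z * z) * qw + y * (z * pvw)) + x * (y * puv + z * puw)
        ≈ ternary qu qv qw puv puw pvw x y z
    collect = solve 9 (λ qu qv qw puv puw pvw x y z →
      (x :* x) :* qu :+ ((y :* y) :* qv :+ (z :* z) :* qw :+ y :* (z :* pvw)) :+ x :* (y :* puv :+ z :* puw)
      := qu :* (x :* x) :+ qv :* (y :* y) :+ qw :* (z :* z)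
         :+ puv :* (x :* y) :+ puw :* (x :* z) :+ pvw :* (y :* z))
      refl

  OrthogonalTo : Vec6 → Vec6 → Vec6 → Vec6 → Set ℓ
  OrthogonalTo a b d w = polar w a ≈ 0# × polar w b ≈ 0# × polar w d ≈ 0#

  orthogonal-echelon : ∀ a b d → Echelon 3 (λ w → Lift (c ⊔ ℓ) (OrthogonalTo a b d w))
  orthogonal-echelon a b d = record
    { vector = vector ; pivot = pivot ; at-pivot = at-pivot ; off-pivot = off-pivot
    ; satisfies = λ k → let (((_ , wa) , wb) , wd) = satisfies k in lift (wa , wb , wd) }
    where
    G₀ G₁ G₂ : Vec6 → Set (c ⊔ ℓ)
    G₀ _ = Lift (c ⊔ ℓ) ⊤
    G₁ w = G₀ w × polar w a ≈ 0#
    G₂ w = G₁ w × polar w b ≈ 0#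
    elim₀ : Eliminable G₀
    elim₀ _ _ _ _ _ = lift tt
    elim₁ : Eliminable G₁
    elim₁ = eliminable-∩-kernel elim₀ (polar-linearˡ a)
    elim₂ : Eliminable G₂
    elim₂ = eliminable-∩-kernel elim₁ (polar-linearˡ b)
    open Echelon (Elimination.eliminate elim₂ (polar-linearˡ d)
                   (Elimination.eliminate elim₁ (polar-linearˡ b)
                     (Elimination.eliminate elim₀ (polar-linearˡ a) standard-basis)))

  plane-meets-quadric : ∀ {u v w} → Independent3 u v w → ∃[ p ] (NonZero p × Q p ≈ 0# × Span3 u v w p)
  plane-meets-quadric {u} {v} {w} indep =
    from-solution (TernaryForm.isotropic (Q u) (Q v) (Q w) (polar u v) (polar u w) (polar v w))
    where
    from-solution : TernaryForm.Isotropic (Q u) (Q v) (Q w) (polar u v) (polar u w) (polar v w) →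
                    ∃[ p ] (NonZero p × Q p ≈ 0# × Span3 u v w p)
    from-solution (x , y , z , nontrivial , T≈0) =
      lin3 x y z u v w , nonzero-combination indep nontrivial , trans (Q-lin3 x y z u v w) T≈0 ,
      x , y , z , (λ _ → refl)

  polar-span3ˡ : ∀ u v w t → polar u t ≈ 0# → polar v t ≈ 0# → polar w t ≈ 0# →
                 ∀ p → Span3 u v w p → polar p t ≈ 0#
  polar-span3ˡ u v w t u⊥t v⊥t w⊥t p (x , y , z , p≈xu+yv+zw) = begin
    polar p t                                       ≈⟨ polar-comm p t ⟩
    polar t p                                       ≈⟨ polar-congʳ t p≈xu+yv+zw ⟩
    polar t (lin3 x y z u v w)                      ≈⟨ polar-comm t (lin3 x y z u v w) ⟩
    polar (lin3 x y z u v w) t                      ≈⟨ polar-lin3ˡ x y z u v w t ⟩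
    x * polar u t + (y * polar v t + z * polar w t)  ≈⟨ combination-cong x y z u⊥t v⊥t w⊥t ⟩
    x * 0# + (y * 0# + z * 0#)                      ≈⟨ vanish x y z ⟩
    0#                                              ∎
    where
    vanish : ∀ x y z → x * 0# + (y * 0# + z * 0#) ≈ 0#
    vanish = solve 3 (λ x y z → x :* con (+ 0) :+ (y :* con (+ 0) :+ z :* con (+ 0)) := con (+ 0)) refl

  orthogonal-plane : ∀ a b d → ∃[ u ] ∃[ v ] ∃[ w ]
    (Independent3 u v w × OrthogonalTo a b d u × OrthogonalTo a b d v × OrthogonalTo a b d w)
  orthogonal-plane a b d =
    vector zero , vector (suc zero) , vector (suc (suc zero)) , echelon-independent E ,
    lower (satisfies zero) , lower (satisfies (suc zero)) , lower (satisfies (suc (suc zero)))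
    where
    E : Echelon 3 (λ w → Lift (c ⊔ ℓ) (OrthogonalTo a b d w))
    E = orthogonal-echelon a b d
    open Echelon E

  perp-meets-quadric : ∀ a b d → ∃[ p ] (NonZero p × Q p ≈ 0# × Perp A (Span3 a b d) p)
  perp-meets-quadric a b d = from-plane (orthogonal-plane a b d)
    where
    from-plane : ∃[ u ] ∃[ v ] ∃[ w ]
      (Independent3 u v w × OrthogonalTo a b d u × OrthogonalTo a b d v × OrthogonalTo a b d w) →
      ∃[ p ] (NonZero p × Q p ≈ 0# × Perp A (Span3 a b d) p)
    from-plane (u , v , w , indep , (u⊥a , u⊥b , u⊥d) , (v⊥a , v⊥b , v⊥d) , (w⊥a , w⊥b , w⊥d)) =
      from-point (plane-meets-quadric indep)
      where
      from-point : ∃[ p ] (NonZero p × Q p ≈ 0# × Span3 u v w p) →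
                   ∃[ p ] (NonZero p × Q p ≈ 0# × Perp A (Span3 a b d) p)
      from-point (p , p≢0 , Qp≈0 , p∈uvw) = p , p≢0 , Qp≈0 , λ y y∈abd →
        trans (Bf≈polar p y) (trans (polar-comm p y)
          (polar-span3ˡ a b d p (⊥p a u⊥a v⊥a w⊥a) (⊥p b u⊥b v⊥b w⊥b) (⊥p d u⊥d v⊥d w⊥d) y y∈abd))
        where
        ⊥p : ∀ t → polar u t ≈ 0# → polar v t ≈ 0# → polar w t ≈ 0# → polar t p ≈ 0#
        ⊥p t u⊥t v⊥t w⊥t = trans (polar-comm t p) (polar-span3ˡ u v w t u⊥t v⊥t w⊥t p p∈uvw)

  ⊥-centre⇒∈H : ∀ h ctr → IsPole A ctr (Hyperplane A h) → ∀ x → polar x ctr ≈ 0# → Hyperplane A h x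
  ⊥-centre⇒∈H h ctr pole x x⊥ctr =
    proj₁ (proj₂ pole x) (trans (Bf≈polar ctr x) (trans (polar-comm ctr x) x⊥ctr))

  -- p lies on the line through the centre and q and is a different point, so the centre lies
  -- on the line through q and p: whatever is orthogonal to q and p is orthogonal to the centre.
  ⊥-image⇒⊥-centre : ∀ ctr q p x → SigmaImage A ctr q p → polar x p ≈ 0# → polar x q ≈ 0# → polar x ctr ≈ 0#
  ⊥-image⇒⊥-centre ctr q p x (_ , _ , (α , β , p≈αc+βq) , p≉q) x⊥p x⊥q = x≉0⇒x*y≈0⇒y≈0 α≉0 (begin
    α * polar x ctr                    ≈⟨ +-identityʳ _ ⟨
    α * polar x ctr + 0#               ≈⟨ +-congˡ (trans (*-congˡ x⊥q) (zeroʳ β)) ⟨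
    α * polar x ctr + β * polar x q    ≈⟨ +-cong (polar-·ʳ α ctr x) (polar-·ʳ β q x) ⟨
    polar x (α · ctr) + polar x (β · q) ≈⟨ polar-⊕ʳ (α · ctr) (β · q) x ⟨
    polar x ((α · ctr) ⊕ (β · q))      ≈⟨ polar-congʳ x p≈αc+βq ⟨
    polar x p                          ≈⟨ x⊥p ⟩
    0#                                 ∎)
    where
    α≉0 : α ≉ 0#
    α≉0 α≈0 = p≉q (β , λ i → trans (p≈αc+βq i)
                     (trans (+-congʳ (trans (*-congʳ α≈0) (zeroˡ (ctr i)))) (+-identityˡ _)))

  two-conics⊈σ-image : ∀ h ctr → IsPole A ctr (Hyperplane A h) → ∀ a b d → Independent3 a b d →
                     (∀ x → TwoConics A a b d x → ¬ Hyperplane A h x) →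
                     ¬ (∀ x → TwoConics A a b d x → ImageSigma A ctr (TwoConics A a b d) x)
  two-conics⊈σ-image h ctr pole a b d indep S∩H≈∅ S⊆Sσ =
    from-points (plane-meets-quadric indep) (perp-meets-quadric a b d)
    where
    S = TwoConics A a b d
    π = Span3 a b d

    from-points : ∃[ p ] (NonZero p × Q p ≈ 0# × π p) → ∃[ y ] (NonZero y × Q y ≈ 0# × Perp A π y) → ⊥
    from-points (p , p≢0 , Qp≈0 , p∈π) (y , y≢0 , Qy≈0 , y⊥π) =
      from-preimage (S⊆Sσ p (p≢0 , Qp≈0 , inj₁ p∈π))
      where
      in-H : ∀ x q → SigmaImage A ctr q p → polar x p ≈ 0# → polar x q ≈ 0# → Hyperplane A h x
      in-H x q p=σq x⊥p x⊥q = ⊥-centre⇒∈H h ctr pole x (⊥-image⇒⊥-centre ctr q p x p=σq x⊥p x⊥q)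

      ⊥π⇒⊥p : ∀ x → Perp A π x → polar x p ≈ 0#
      ⊥π⇒⊥p x x⊥π = trans (sym (Bf≈polar x p)) (x⊥π p p∈π)

      from-preimage : ImageSigma A ctr S p → ⊥
      from-preimage (q , (_ , _ , inj₁ q∈π) , p=σq) =
        S∩H≈∅ y (y≢0 , Qy≈0 , inj₂ y⊥π)
          (in-H y q p=σq (⊥π⇒⊥p y y⊥π) (trans (sym (Bf≈polar y q)) (y⊥π q q∈π)))
      from-preimage (q , Sq@(_ , Qq≈0 , inj₂ q⊥π) , p=σq) =
        S∩H≈∅ q Sq
          (in-H q q p=σq (⊥π⇒⊥p q q⊥π) (trans (polar-self q) (trans (+-cong Qq≈0 Qq≈0) (+-identityʳ 0#))))

lemma4p8 : {c ℓ : Level} (F : FiniteField c ℓ) → FiniteField.order F > 2 →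
    let open FiniteField F in
    let open Geometry F in
    (A : QForm) → Elliptic A →
    (h ctr : Vec6) → NonZero h →
    NonsingularOn A (Hyperplane A h) →
    IsPole A ctr (Hyperplane A h) →
    (a b d : Vec6) → Independent3 a b d →
    NonsingularOn A (Span3 a b d) →
    NonsingularOn A (Perp A (Span3 a b d)) →
    (∀ x → TwoConics A a b d x → ¬ Hyperplane A h x) →
    ¬ (∀ x → (ImageSigma A ctr (TwoConics A a b d) x → TwoConics A a b d x)
           × (TwoConics A a b d x → ImageSigma A ctr (TwoConics A a b d) x))
lemma4p8 F _ A _ h ctr _ _ pole a b d indep _ _ S∩H≈∅ Sσ≈S =
  QuadraticSpace.two-conics⊈σ-image F A h ctr pole a b d indep S∩H≈∅ (λ x → proj₂ (Sσ≈S x))
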